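{- $\mathbf{CL13}$ is a conservative extension of classical logic: an elementary formula (a formula containing no general atoms and no operators other than $\neg,\top,\bot,\wedge,\vee$) is provable in $\mathbf{CL13}$ if and only if it is a tautology of classical propositional logic.
   Context: Language of $\mathbf{CL13}$: infinitely many nonlogical elementary atoms $p,q,\dots$; infinitely many general atoms $P,Q,\dots$; logical atoms $\top,\bot$; $\neg$ applied only to nonlogical atoms; connectives $\wedge,\vee,\curlywedge,\curlyvee,\vartriangle,\triangledown,\sqcap,\sqcup$ of any arity $n\ge2$. For compound $F$, $\neg F$ abbreviates its De Morgan dual ($\neg\neg E=E$, $\neg\top=\bot$, $\neg\bot=\top$, $\neg$ interchanges $\wedge/\vee$, $\curlywedge/\curlyvee$, $\vartriangle/\triangledown$, $\sqcap/\sqcup$ and negates the components). An occurrence is surface if it is in the scope of no connectives other than $\neg,\wedge,\vee$, and semisurface if in the scope of no $\sqcap,\sqcup$. A formula is quasielementary iff it contains no general atoms and no operators other than $\neg,\top,\bot,\wedge,\vee,\curlywedge,\curlyvee$. The quasielementarization $|F|$ replaces every sequential subformula $E_1\vartriangle\dots\vartriangle E_n$ or $E_1\triangledown\dots\triangledown E_n$ by its head $E_1$, every $\sqcap$-subformula by $\top$, every $\sqcup$-subformula by $\bot$, and every occurrence of a general literal ($P$ or $\neg P$) by $\bot$. The elementarization $\|F\|$ of a quasielementary $F$ replaces every $\curlywedge$-subformula by $\top$ and every $\curlyvee$-subformula by $\bot$; a quasielementary $F$ is stable iff $\|F\|$ is a classical tautology. Rules ($E_2\vartriangle\dots\vartriangle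 E_n$ means $E_2$ if $n=2$): ($\curlywedge$) $\vec H\mapsto F$, $F$ stable quasielementary, $\vec H$ the set of all results of replacing a surface occurrence of $E_1\curlywedge\dots\curlywedge E_n$ in $F$ by some $E_i$ (possibly empty); ($\curlyvee$) $H\mapsto F$, $F$ quasielementary, $H$ replaces a surface $E_1\curlyvee\dots\curlyvee E_n$ by some $E_i$; ($\vartriangle\sqcap$) $|F|,\vec H\mapsto F$, $F$ not quasielementary, $\vec H$ all results of replacing a semisurface $E_1\sqcap\dots\sqcap E_n$ by some $E_i$ and all results of replacing a semisurface $E_1\vartriangle E_2\vartriangle\dots\vartriangle E_n$ by $E_2\vartriangle\dots\vartriangle E_n$; ($\sqcup$) $H\mapsto F$, $H$ replaces a semisurface $E_1\sqcup\dots\sqcup E_n$ by some $E_i$; ($\triangledown$) $H\mapsto F$, $H$ replaces a semisurface $E_1\triangledown E_2\triangledown\dots\triangledown E_n$ by $E_2\triangledown\dots\triangledown E_n$; (M) $H\mapsto F$, $H$ replaces one positive and one negative semisurface occurrence of a general atom $P$ by a nonlogical elementary atom $p$ not occurring in $F$. Provability means derivability by these rules. -}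

module Defs where

open import Data.Nat using (ℕ)
open import Data.Bool using (Bool; true; false; _∧_; _∨_; not; T)
open import Data.List using (List; []; _∷_)
open import Data.List.Membership.Propositional using (_∈_)
open import Data.Product using (Σ; _×_; ∃)
open import Data.Sum using (_⊎_)
open import Data.Empty using (⊥)
open import Data.Unit using (⊤)
open import Relation.Nullary using (¬_)
open import Relation.Binary.PropositionalEquality using (_≡_)

-- Connectives: ∧ ∨ (parallel-classical), ⋏ ⋎ (choice-like "toggling"
-- ⋏/⋎ of the paper, written \curlywedge/\curlyvee), △ ▽ (sequential),
-- ⊓ ⊔ (choice).
data Conn : Set where
  cAnd cOr cCAnd cCOr cSAnd cSOr cChAnd cChOr : Conn

-- Negation only on nonlogical atoms: elementary literals p / ¬p and
-- general literals P / ¬P.  A compound formula with connective c has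
-- n ≥ 2 components: first, second, and a list of further ones.
data Formula : Set where
  eAtom  : ℕ → Formula
  neAtom : ℕ → Formula
  gAtom  : ℕ → Formula
  ngAtom : ℕ → Formula
  top    : Formula
  bot    : Formula
  op     : Conn → Formula → Formula → List Formula → Formula

mutual
  isElem : Formula → Bool
  isElem (eAtom _)  = true
  isElem (neAtom _) = true
  isElem (gAtom _)  = false
  isElem (ngAtom _) = false
  isElem top = true
  isElem bot = true
  isElem (op cAnd a b cs) = isElem a ∧ isElem b ∧ isElemL cs
  isElem (op cOr  a b cs) = isElem a ∧ isElem b ∧ isElemL cs
  isElem (op _ _ _ _) = false

  isElemL : List Formula → Bool
  isElemL [] = true
  isElemL (x ∷ xs) = isElem x ∧ isElemL xs

Elementary : Formula → Set
Elementary F = T (isElem F)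

mutual
  isQuasi : Formula → Bool
  isQuasi (eAtom _)  = true
  isQuasi (neAtom _) = true
  isQuasi (gAtom _)  = false
  isQuasi (ngAtom _) = false
  isQuasi top = true
  isQuasi bot = true
  isQuasi (op cAnd  a b cs) = isQuasi a ∧ isQuasi b ∧ isQuasiL cs
  isQuasi (op cOr   a b cs) = isQuasi a ∧ isQuasi b ∧ isQuasiL cs
  isQuasi (op cCAnd a b cs) = isQuasi a ∧ isQuasi b ∧ isQuasiL cs
  isQuasi (op cCOr  a b cs) = isQuasi a ∧ isQuasi b ∧ isQuasiL cs
  isQuasi (op _ _ _ _) = false

  isQuasiL : List Formula → Bool
  isQuasiL [] = true
  isQuasiL (x ∷ xs) = isQuasi x ∧ isQuasiL xs

Quasielementary : Formula → Set
Quasielementary F = T (isQuasi F)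

Valuation : Set
Valuation = ℕ → Bool

-- classical truth value; meaningful on elementary formulas
-- (general atoms and non-classical connectives get arbitrary values;
-- eval is only ever applied to elementary formulas below)
mutual
  eval : Valuation → Formula → Bool
  eval v (eAtom p)  = v p
  eval v (neAtom p) = not (v p)
  eval v (gAtom _)  = false
  eval v (ngAtom _) = false
  eval v top = true
  eval v bot = false
  eval v (op cOr a b cs) = eval v a ∨ eval v b ∨ evalOr v cs
  eval v (op _   a b cs) = eval v a ∧ eval v b ∧ evalAnd v cs

  evalAnd : Valuation → List Formula → Bool
  evalAnd v [] = true
  evalAnd v (x ∷ xs) = eval v x ∧ evalAnd v xs

  evalOr : Valuation → List Formula → Bool
  evalOr v [] = false
  evalOr v (x ∷ xs) = eval v x ∨ evalOr v xs

Tautology : Formula → Set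
Tautology F = (v : Valuation) → eval v F ≡ true

mutual
  elemz : Formula → Formula
  elemz (op cCAnd _ _ _) = top
  elemz (op cCOr  _ _ _) = bot
  elemz (op c a b cs) = op c (elemz a) (elemz b) (elemzL cs)
  elemz F = F

  elemzL : List Formula → List Formula
  elemzL [] = []
  elemzL (x ∷ xs) = elemz x ∷ elemzL xs

Stable : Formula → Set
Stable F = Quasielementary F × Tautology (elemz F)

mutual
  qelemz : Formula → Formula
  qelemz (gAtom _)  = bot
  qelemz (ngAtom _) = bot
  qelemz (op cSAnd a _ _) = qelemz a
  qelemz (op cSOr  a _ _) = qelemz a
  qelemz (op cChAnd _ _ _) = top
  qelemz (op cChOr  _ _ _) = bot
  qelemz (op c a b cs) = op c (qelemz a) (qelemz b) (qelemzL cs)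
  qelemz F = F

  qelemzL : List Formula → List Formula
  qelemzL [] = []
  qelemzL (x ∷ xs) = qelemz x ∷ qelemzL xs

-- connectives through which a surface occurrence may pass (¬ is only on
-- atoms, so only ∧ and ∨ matter)
SurfConn : Conn → Set
SurfConn cAnd = ⊤
SurfConn cOr  = ⊤
SurfConn _    = ⊥

SemiConn : Conn → Set
SemiConn cChAnd = ⊥
SemiConn cChOr  = ⊥
SemiConn _      = ⊤

-- Repl Ok R F G : G is the result of replacing in F one occurrence X
-- (in the scope of connectives satisfying Ok only) by some Y with R X Y.
mutual
  data Repl (Ok : Conn → Set) (R : Formula → Formula → Set) : Formula → Formula → Set where
    here   : ∀ {X Y} → R X Y → Repl Ok R X Y
    inside : ∀ {c a b cs a' b' cs'} → Ok c →
             ReplL Ok R (a ∷ b ∷ cs) (a' ∷ b' ∷ cs') →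
             Repl Ok R (op c a b cs) (op c a' b' cs')

  data ReplL (Ok : Conn → Set) (R : Formula → Formula → Set) : List Formula → List Formula → Set where
    hd : ∀ {x y xs} → Repl Ok R x y → ReplL Ok R (x ∷ xs) (y ∷ xs)
    tl : ∀ {x xs ys} → ReplL Ok R xs ys → ReplL Ok R (x ∷ xs) (x ∷ ys)

data Choose (c : Conn) : Formula → Formula → Set where
  choose : ∀ {a b cs y} → y ∈ (a ∷ b ∷ cs) → Choose c (op c a b cs) y

data Advance (c : Conn) : Formula → Formula → Set where
  adv2 : ∀ {a b} → Advance c (op c a b []) b
  advN : ∀ {a b d ds} → Advance c (op c a b (d ∷ ds)) (op c b d ds)

data Lit (X Y : Formula) : Formula → Formula → Set where
  lit : Lit X Y X Y

mutual
  occursE : ℕ → Formula → Set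
  occursE p (eAtom q)  = p ≡ q
  occursE p (neAtom q) = p ≡ q
  occursE p (op _ a b cs) = occursE p a ⊎ occursE p b ⊎ occursEL p cs
  occursE p _ = ⊥

  occursEL : ℕ → List Formula → Set
  occursEL p [] = ⊥
  occursEL p (x ∷ xs) = occursE p x ⊎ occursEL p xs

data Provable : Formula → Set where
  rule-⋏  : ∀ {F} → Quasielementary F → Stable F →
            (∀ G → Repl SurfConn (Choose cCAnd) F G → Provable G) →
            Provable F
  rule-⋎  : ∀ {F H} → Quasielementary F →
            Repl SurfConn (Choose cCOr) F H → Provable H → Provable F
  rule-△⊓ : ∀ {F} → ¬ Quasielementary F → Provable (qelemz F) →
            (∀ G → Repl SemiConn (Choose cChAnd) F G ⊎ Repl SemiConn (Advance cSAnd) F G →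
                   Provable G) →
            Provable F
  rule-⊔  : ∀ {F H} → Repl SemiConn (Choose cChOr) F H → Provable H → Provable F
  rule-▽  : ∀ {F H} → Repl SemiConn (Advance cSOr) F H → Provable H → Provable F
  rule-M  : ∀ {F G H} (P p : ℕ) → ¬ occursE p F →
            Repl SemiConn (Lit (gAtom P) (eAtom p)) F G →
            Repl SemiConn (Lit (ngAtom P) (neAtom p)) G H →
            Provable H → Provable F

module Submission where

open import Defs
open import Data.Bool using (T; _∧_)
open import Data.Bool.Properties using (T-∧)
open import Data.List using (List; []; _∷_)
open import Data.Product using (_×_; _,_; proj₁; proj₂; map; map₂)
open import Data.Empty using (⊥-elim)
open import Data.Unit using (tt)
open import Function using (_∘_)
open import Function.Bundles using (module Equivalence)
open import Relation.Nullary using (¬_)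
open import Relation.Binary.PropositionalEquality using (_≡_; refl; subst; sym)

open Equivalence using (to; from)

-- An elementary formula contains no occurrence of a non-classical connective
-- or of a general atom, so every rule except (⋏) is inapplicable to it, and
-- (⋏) has no premises and asks exactly that ‖F‖ = F be a classical tautology.

T-∧-map : ∀ {x y x′ y′} → (T x → T x′) → (T y → T y′) → T (x ∧ y) → T (x′ ∧ y′)
T-∧-map f g = from T-∧ ∘ map f g ∘ to T-∧

T-∧₃ : ∀ {x y z} → T (x ∧ y ∧ z) → T x × T y × T z
T-∧₃ = map₂ (to T-∧) ∘ to T-∧

ElementaryL : List Formula → Set
ElementaryL cs = T (isElemL cs)

elementary-op : ∀ {c a b cs} → Elementary (op c a b cs) → SurfConn c × ElementaryL (a ∷ b ∷ cs)
elementary-op {cAnd}   e = tt , e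
elementary-op {cOr}    e = tt , e
elementary-op {cCAnd}  ()
elementary-op {cCOr}   ()
elementary-op {cSAnd}  ()
elementary-op {cSOr}   ()
elementary-op {cChAnd} ()
elementary-op {cChOr}  ()

mutual
  elementary-¬Repl : ∀ {Ok R F G} → (∀ {X Y} → R X Y → ¬ Elementary X) →
                     Elementary F → ¬ Repl Ok R F G
  elementary-¬Repl ¬redex e (here r)      = ¬redex r e
  elementary-¬Repl ¬redex e (inside {c} {a} {b} {cs} _ rs) =
    elementary-¬ReplL ¬redex (proj₂ (elementary-op {c} {a} {b} {cs} e)) rs

  elementary-¬ReplL : ∀ {Ok R xs ys} → (∀ {X Y} → R X Y → ¬ Elementary X) →
                      ElementaryL xs → ¬ ReplL Ok R xs ys
  elementary-¬ReplL ¬redex e (hd r)  = elementary-¬Repl ¬redex (proj₁ (to T-∧ e)) r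
  elementary-¬ReplL ¬redex e (tl rs) = elementary-¬ReplL ¬redex (proj₂ (to T-∧ e)) rs

¬elementary-choose : ∀ {c X Y} → ¬ SurfConn c → Choose c X Y → ¬ Elementary X
¬elementary-choose {c} ¬c (choose {a} {b} {cs} _) = ¬c ∘ proj₁ ∘ elementary-op {c} {a} {b} {cs}

¬elementary-advance : ∀ {c X Y} → ¬ SurfConn c → Advance c X Y → ¬ Elementary X
¬elementary-advance {c} ¬c (adv2 {a} {b})        = ¬c ∘ proj₁ ∘ elementary-op {c} {a} {b} {[]}
¬elementary-advance {c} ¬c (advN {a} {b} {d} {ds}) = ¬c ∘ proj₁ ∘ elementary-op {c} {a} {b} {d ∷ ds}

mutual
  elementary⇒quasielementary : ∀ F → Elementary F → Quasielementary F
  elementary⇒quasielementary (eAtom _)        _ = tt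
  elementary⇒quasielementary (neAtom _)       _ = tt
  elementary⇒quasielementary top              _ = tt
  elementary⇒quasielementary bot              _ = tt
  elementary⇒quasielementary (op cAnd a b cs) e =
    T-∧-map (elementary⇒quasielementary a) (T-∧-map (elementary⇒quasielementary b) (elementaryL⇒quasielementaryL cs)) e
  elementary⇒quasielementary (op cOr a b cs)  e =
    T-∧-map (elementary⇒quasielementary a) (T-∧-map (elementary⇒quasielementary b) (elementaryL⇒quasielementaryL cs)) e

  elementaryL⇒quasielementaryL : ∀ cs → ElementaryL cs → T (isQuasiL cs)
  elementaryL⇒quasielementaryL []       _ = tt
  elementaryL⇒quasielementaryL (x ∷ xs) e =
    T-∧-map (elementary⇒quasielementary x) (elementaryL⇒quasielementaryL xs) e

mutual
  elemz-elementary : ∀ F → Elementary F → elemz F ≡ F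
  elemz-elementary (eAtom _)  _ = refl
  elemz-elementary (neAtom _) _ = refl
  elemz-elementary top        _ = refl
  elemz-elementary bot        _ = refl
  elemz-elementary (op cAnd a b cs) e
    with ea , eb , ecs ← T-∧₃ e
    rewrite elemz-elementary a ea | elemz-elementary b eb | elemzL-elementary cs ecs = refl
  elemz-elementary (op cOr a b cs) e
    with ea , eb , ecs ← T-∧₃ e
    rewrite elemz-elementary a ea | elemz-elementary b eb | elemzL-elementary cs ecs = refl

  elemzL-elementary : ∀ cs → ElementaryL cs → elemzL cs ≡ cs
  elemzL-elementary []       _ = refl
  elemzL-elementary (x ∷ xs) e
    with ex , exs ← to T-∧ e
    rewrite elemz-elementary x ex | elemzL-elementary xs exs = refl

elementary-stable : ∀ F → Elementary F → Tautology F → Stable F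
elementary-stable F e t =
  elementary⇒quasielementary F e , subst Tautology (sym (elemz-elementary F e)) t

elementary-sound : ∀ F → Elementary F → Provable F → Tautology F
elementary-sound F e (rule-⋏ _ (_ , t) _) = subst Tautology (elemz-elementary F e) t
elementary-sound F e (rule-△⊓ ¬q _ _)     = ⊥-elim (¬q (elementary⇒quasielementary F e))
elementary-sound _ e (rule-⋎ _ r _)       = ⊥-elim (elementary-¬Repl (¬elementary-choose λ ()) e r)
elementary-sound _ e (rule-⊔ r _)         = ⊥-elim (elementary-¬Repl (¬elementary-choose λ ()) e r)
elementary-sound _ e (rule-▽ r _)         = ⊥-elim (elementary-¬Repl (¬elementary-advance λ ()) e r)
elementary-sound _ e (rule-M _ _ _ r _ _) = ⊥-elim (elementary-¬Repl (λ { lit () }) e r)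

elementary-complete : ∀ F → Elementary F → Tautology F → Provable F
elementary-complete F e t =
  rule-⋏ (proj₁ stable) stable λ _ r → ⊥-elim (elementary-¬Repl (¬elementary-choose λ ()) e r)
  where
  stable : Stable F
  stable = elementary-stable F e t

fact4p8 : (F : Formula) → Elementary F → (Provable F → Tautology F) × (Tautology F → Provable F)
fact4p8 F e = elementary-sound F e , elementary-complete F e
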